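{- Let $L=\{u_1,\dots,u_n\}$ and $R=\{v_1,\dots,v_n\}$ be disjoint finite sets and let $w:L\times R\to\{1,2,3\}$ be arbitrary. Then there exists a finite undirected unweighted graph $G$ containing $L\cup R$ and two further vertices $u,v$ with $\{u,v\}\in E(G)$, such that $\mathsf{Nbr}_G(u)\setminus(\mathsf{Nbr}_G(v)\cup\{v\})=L$, $\mathsf{Nbr}_G(v)\setminus(\mathsf{Nbr}_G(u)\cup\{u\})=R$, $\deg_G(u)=\deg_G(v)$, and $\mathrm{dist}_G(x,y)=w(x,y)$ for all $x\in L$, $y\in R$.
   Context: $\mathsf{Nbr}_G(x)$ denotes the set of neighbors of $x$ in $G$, $\deg_G(x)=|\mathsf{Nbr}_G(x)|$, and $\mathrm{dist}_G(x,y)$ is the number of edges on a shortest $x$–$y$ path in $G$. (The paper phrases the conclusion as "$G_{u,v}=H$" for the complete bipartite graph $H=(L,R,w)$, in the notation where, for an edge $\{u,v\}$ with $\deg_G(u)=\deg_G(v)$, one sets $L=\mathsf{Nbr}_G(u)\setminus(\mathsf{Nbr}_G(v)\cup\{v\})$, $R=\mathsf{Nbr}_G(v)\setminus(\mathsf{Nbr}_G(u)\cup\{u\})$, $w(x,y)=\mathrm{dist}_G(x,y)$.) -}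

module Defs where

open import Data.Nat using (ℕ; zero; suc; _≤_)
open import Data.Fin using (Fin)
open import Data.Bool using (Bool; true; false; T; if_then_else_)
open import Data.List using (List; map; allFin)
open import Data.Nat.ListAction using (sum)
open import Data.Product using (∃; _×_)
open import Relation.Binary.PropositionalEquality using (_≡_)
open import Relation.Nullary using (¬_)

record Graph : Set where
  field
    N     : ℕ
    adj   : Fin N → Fin N → Bool
    sym   : ∀ x y → adj x y ≡ adj y x
    irrefl : ∀ x → adj x x ≡ false
open Graph public

Adj : (G : Graph) → Fin (N G) → Fin (N G) → Set
Adj G x y = T (adj G x y)

deg : (G : Graph) → Fin (N G) → ℕ
deg G x = sum (map (λ y → if adj G x y then 1 else 0) (allFin (N G)))

data Walk (G : Graph) : Fin (N G) → Fin (N G) → ℕ → Set where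
  [] : ∀ {x} → Walk G x x zero
  _∷_ : ∀ {x y z k} → Adj G x y → Walk G y z k → Walk G x z (suc k)

Dist : (G : Graph) → Fin (N G) → Fin (N G) → ℕ → Set
Dist G x y d = Walk G x y d × (∀ k → Walk G x y k → d ≤ k)

{-# OPTIONS --safe #-}
-- Besides u, v, the ℓ i and the r j, take a vertex mid i j for every pair, with
-- edges u–v, u–ℓ i, v–r j, ℓ i–r j when w i j = 1, and ℓ i–mid i j–r j when
-- w i j = 2. Swapping u ↔ v and ℓ i ↔ r i maps the neighbourhood of u onto that
-- of v, so their degrees agree. ℓ i–u–v–r j is always a walk of length 3, and a
-- shorter one exists exactly when w i j ∈ {1, 2}, since mid i j is the only
-- possible common neighbour of ℓ i and r j.
module Submission where

open import Defs hiding (sym)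
open import Data.Nat using (ℕ; zero; suc; _+_; _*_; _≤_; _≡ᵇ_; s≤s)
open import Data.Nat.Properties using (≤-trans; ≤-reflexive; m≤m+n; ≡ᵇ⇒≡; ≡⇒≡ᵇ; +-0-commutativeMonoid)
open import Data.Fin using (Fin; _≟_)
open import Data.Fin.Patterns using (0F; 1F)
open import Data.Fin.Properties using (+↔⊎; *↔×)
open import Data.Fin.Permutation using (Permutation′; _⟨$⟩ʳ_)
open import Algebra.Properties.CommutativeMonoid.Sum +-0-commutativeMonoid using (sum-permute; sum-cong-≗) renaming (sum to ∑)
open import Data.Bool using (Bool; true; false; T; if_then_else_; _∧_; _∨_)
open import Data.Bool.Properties using (T-∧; ∨-comm)
open import Data.List using (map; allFin; tabulate)
open import Data.List.Properties using (map-tabulate)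
open import Data.Nat.ListAction using (sum)
open import Data.Sum using (_⊎_; inj₁; inj₂)
open import Data.Sum.Properties using (inj₁-injective; inj₂-injective)
open import Data.Sum.Function.Propositional using (_⊎-↔_)
open import Data.Product using (Σ; ∃; _×_; _,_)
open import Data.Unit using (tt)
open import Data.Empty using (⊥-elim)
open import Function using (_∘_; id)
open import Function.Bundles using (_↔_; Inverse; mk↔ₛ′; _⇔_; mk⇔; Equivalence)
open import Function.Construct.Composition using (_↔-∘_)
open import Function.Construct.Identity using (↔-id)
open import Function.Construct.Symmetry using (↔-sym)
open import Function.Definitions using (Injective)
open import Relation.Binary.PropositionalEquality using (_≡_; _≢_; refl; sym; trans; cong; cong₂; module ≡-Reasoning)
open import Relation.Nullary using (¬_)
open import Relation.Nullary.Decidable using (⌊_⌋; toWitness; fromWitness)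

sum-tabulate : ∀ {m} (f : Fin m → ℕ) → sum (tabulate f) ≡ ∑ f
sum-tabulate {zero}  f = refl
sum-tabulate {suc m} f = cong (f 0F +_) (sum-tabulate (f ∘ Fin.suc))

sum-allFin : ∀ {m} (f : Fin m → ℕ) → sum (map f (allFin m)) ≡ ∑ f
sum-allFin f = trans (cong sum (map-tabulate (λ i → i) f)) (sum-tabulate f)

deg-permute : (G : Graph) {x y : Fin (N G)} (π : Permutation′ (N G)) →
        (∀ z → adj G y (π ⟨$⟩ʳ z) ≡ adj G x z) → deg G x ≡ deg G y
deg-permute G {x} {y} π adj-π = begin
  deg G x                         ≡⟨ sum-allFin (indicator x) ⟩
  ∑ (indicator x)                 ≡⟨ sum-cong-≗ (λ z → cong (λ b → if b then 1 else 0) (sym (adj-π z))) ⟩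
  ∑ (indicator y ∘ (π ⟨$⟩ʳ_))     ≡⟨ sum-permute (indicator y) π ⟨
  ∑ (indicator y)                 ≡⟨ sum-allFin (indicator y) ⟨
  deg G y                         ∎
  where
  open ≡-Reasoning
  indicator : Fin (N G) → Fin (N G) → ℕ
  indicator x z = if adj G x z then 1 else 0

Dist-≤3 : ∀ {G x y d} → d ≤ 3 → Walk G x y d → x ≢ y →
          (Adj G x y → d ≤ 1) → (∀ {z} → Adj G x z → Adj G z y → d ≤ 2) →
          Dist G x y d
Dist-≤3 {G} {x} {y} {d} d≤3 walk x≢y adjacent⇒ common⇒ = walk , shortest
  where
  shortest : ∀ k → Walk G x y k → d ≤ k
  shortest zero                []               = ⊥-elim (x≢y refl)
  shortest (suc zero)          (xy ∷ [])        = adjacent⇒ xy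
  shortest (suc (suc zero))    (xz ∷ (zy ∷ [])) = common⇒ xz zy
  shortest (suc (suc (suc k))) _                = ≤-trans d≤3 (m≤m+n 3 k)

module Enumerated {V : Set} {N : ℕ} (enumeration : Fin N ↔ V) (_∼_ : V → V → Bool)
                  (∼-sym : ∀ a b → a ∼ b ≡ b ∼ a) (∼-irrefl : ∀ a → a ∼ a ≡ false) where

  vertex : Fin N → V
  vertex = Inverse.to enumeration

  index : V → Fin N
  index = Inverse.from enumeration

  vertex-index : ∀ a → vertex (index a) ≡ a
  vertex-index = Inverse.strictlyInverseˡ enumeration

  index-vertex : ∀ x → index (vertex x) ≡ x
  index-vertex = Inverse.strictlyInverseʳ enumeration

  graph : Graph
  graph = record
    { N      = N
    ; adj    = λ x y → vertex x ∼ vertex y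
    ; sym    = λ x y → ∼-sym (vertex x) (vertex y)
    ; irrefl = λ x → ∼-irrefl (vertex x)
    }

  index-injective : Injective _≡_ _≡_ index
  index-injective {a} {b} e = trans (sym (vertex-index a)) (trans (cong vertex e) (vertex-index b))

  index-≢ : ∀ {a b} → a ≢ b → index a ≢ index b
  index-≢ a≢b = a≢b ∘ index-injective

  Adj⇔∼ : ∀ {a b x y} → vertex x ≡ a → vertex y ≡ b → Adj graph x y ⇔ T (a ∼ b)
  Adj⇔∼ refl refl = mk⇔ id id

  Adj-index : ∀ {a b} → T (a ∼ b) → Adj graph (index a) (index b)
  Adj-index = Equivalence.from (Adj⇔∼ (vertex-index _) (vertex-index _))

  infixr 5 _∼⟨_⟩_
  infix 6 _∎

  data Path : V → V → ℕ → Set where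
    _∎     : ∀ a → Path a a 0
    _∼⟨_⟩_ : ∀ a {b c k} → T (a ∼ b) → Path b c k → Path a c (suc k)

  index-walk : ∀ {a b k} → Path a b k → Walk graph (index a) (index b) k
  index-walk (a ∎)             = []
  index-walk (a ∼⟨ a∼b ⟩ path) = Adj-index a∼b ∷ index-walk path

  deg-index : ∀ {a b} (σ : V ↔ V) → (∀ c → b ∼ Inverse.to σ c ≡ a ∼ c) →
              deg graph (index a) ≡ deg graph (index b)
  deg-index {a} {b} σ b∼σ = deg-permute graph (↔-sym enumeration ↔-∘ (σ ↔-∘ enumeration)) λ z →
    trans (cong₂ _∼_ (vertex-index b) (vertex-index _))
          (trans (b∼σ (vertex z)) (cong (_∼ vertex z) (sym (vertex-index a))))

  index-exclusive-neighbours : ∀ {I : Set} {a b : V} {f : I → V} →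
    (∀ c → (T (a ∼ c) × ¬ T (b ∼ c) × c ≢ b) ⇔ ∃ λ i → f i ≡ c) →
    ∀ x → (Adj graph (index a) x × ¬ Adj graph (index b) x × x ≢ index b) ⇔ ∃ λ i → index (f i) ≡ x
  index-exclusive-neighbours {a = a} {b} {f} exclusive x = mk⇔ to from
    where
    to : Adj graph (index a) x × ¬ Adj graph (index b) x × x ≢ index b → ∃ λ i → index (f i) ≡ x
    to (ax , ¬bx , x≢b) with Equivalence.to (exclusive (vertex x))
      ( Equivalence.to (Adj⇔∼ (vertex-index a) refl) ax
      , ¬bx ∘ Equivalence.from (Adj⇔∼ (vertex-index b) refl)
      , λ x∼b → x≢b (trans (sym (index-vertex x)) (cong index x∼b)) )
    ... | i , fi≡x = i , trans (cong index fi≡x) (index-vertex x)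

    from : (∃ λ i → index (f i) ≡ x) → Adj graph (index a) x × ¬ Adj graph (index b) x × x ≢ index b
    from (i , refl) with Equivalence.from (exclusive (f i)) (i , refl)
    ... | a∼fi , ¬b∼fi , fi≢b =
      Adj-index a∼fi , ¬b∼fi ∘ Equivalence.to (Adj⇔∼ (vertex-index b) (vertex-index (f i))) , index-≢ fi≢b

  index-Dist : ∀ {a b d} → d ≤ 3 → Path a b d → a ≢ b →
               (T (a ∼ b) → d ≤ 1) → (∀ c → T (a ∼ c) → T (c ∼ b) → d ≤ 2) →
               Dist graph (index a) (index b) d
  index-Dist {a} {b} d≤3 path a≢b adjacent⇒ common⇒ = Dist-≤3 d≤3 (index-walk path) (index-≢ a≢b)
    (adjacent⇒ ∘ Equivalence.to (Adj⇔∼ (vertex-index a) (vertex-index b)))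
    (λ {z} az zb → common⇒ (vertex z) (Equivalence.to (Adj⇔∼ (vertex-index a) refl) az)
                                      (Equivalence.to (Adj⇔∼ refl (vertex-index b)) zb))

Vertex : ℕ → Set
Vertex n = Fin 2 ⊎ Fin n ⊎ Fin n ⊎ Fin n × Fin n

pattern u       = inj₁ 0F
pattern v       = inj₁ 1F
pattern ℓ i     = inj₂ (inj₁ i)
pattern r j     = inj₂ (inj₂ (inj₁ j))
pattern mid i j = inj₂ (inj₂ (inj₂ (i , j)))

Fin↔Vertex : ∀ n → Fin (2 + (n + (n + n * n))) ↔ Vertex n
Fin↔Vertex n = (↔-id _ ⊎-↔ ((↔-id _ ⊎-↔ ((↔-id _ ⊎-↔ *↔×) ↔-∘ +↔⊎)) ↔-∘ +↔⊎)) ↔-∘ +↔⊎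

module Construction (n : ℕ) (w : Fin n → Fin n → ℕ) where

  edge : Vertex n → Vertex n → Bool
  edge u         v          = true
  edge u         (ℓ i)      = true
  edge v         (r j)      = true
  edge (ℓ i)     (r j)      = w i j ≡ᵇ 1
  edge (ℓ i)     (mid i′ j) = ⌊ i ≟ i′ ⌋
  edge (mid i j) (r j′)     = ⌊ j ≟ j′ ⌋ ∧ (w i j ≡ᵇ 2)
  edge _         _          = false

  -- Reversed edges reduce to false, so with this orientation  a ∼ b  computes
  -- to  edge a b  for every edge listed above.
  _∼_ : Vertex n → Vertex n → Bool
  a ∼ b = edge b a ∨ edge a b

  ∼-sym : ∀ a b → a ∼ b ≡ b ∼ a
  ∼-sym a b = ∨-comm (edge b a) (edge a b)

  ∼-irrefl : ∀ a → a ∼ a ≡ false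
  ∼-irrefl u         = refl
  ∼-irrefl v         = refl
  ∼-irrefl (ℓ i)     = refl
  ∼-irrefl (r j)     = refl
  ∼-irrefl (mid i j) = refl

  open Enumerated (Fin↔Vertex n) _∼_ ∼-sym ∼-irrefl public

  swap : Vertex n → Vertex n
  swap u         = v
  swap v         = u
  swap (ℓ i)     = r i
  swap (r j)     = ℓ j
  swap (mid i j) = mid i j

  swap-involutive : ∀ a → swap (swap a) ≡ a
  swap-involutive u         = refl
  swap-involutive v         = refl
  swap-involutive (ℓ i)     = refl
  swap-involutive (r j)     = refl
  swap-involutive (mid i j) = refl

  swap-↔ : Vertex n ↔ Vertex n
  swap-↔ = mk↔ₛ′ swap swap swap-involutive swap-involutive

  v∼swap : ∀ c → v ∼ swap c ≡ u ∼ c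
  v∼swap u         = refl
  v∼swap v         = refl
  v∼swap (ℓ i)     = refl
  v∼swap (r j)     = refl
  v∼swap (mid i j) = refl

  u-exclusive-neighbours : ∀ c → (T (u ∼ c) × ¬ T (v ∼ c) × c ≢ v) ⇔ ∃ λ i → ℓ i ≡ c
  u-exclusive-neighbours c = mk⇔ (to c) λ { (i , refl) → tt , (λ ()) , (λ ()) }
    where
    to : ∀ c → T (u ∼ c) × ¬ T (v ∼ c) × c ≢ v → ∃ λ i → ℓ i ≡ c
    to u         (() , _)
    to v         (_ , _ , v≢v) = ⊥-elim (v≢v refl)
    to (ℓ i)     _             = i , refl
    to (r j)     (() , _)
    to (mid i j) (() , _)

  v-exclusive-neighbours : ∀ c → (T (v ∼ c) × ¬ T (u ∼ c) × c ≢ u) ⇔ ∃ λ j → r j ≡ c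
  v-exclusive-neighbours c = mk⇔ (to c) λ { (j , refl) → tt , (λ ()) , (λ ()) }
    where
    to : ∀ c → T (v ∼ c) × ¬ T (u ∼ c) × c ≢ u → ∃ λ j → r j ≡ c
    to u         (_ , _ , u≢u) = ⊥-elim (u≢u refl)
    to v         (() , _)
    to (ℓ i)     (() , _)
    to (r j)     _             = j , refl
    to (mid i j) (() , _)

  common-neighbour⇒w≡2 : ∀ {i j} c → T (ℓ i ∼ c) → T (c ∼ r j) → w i j ≡ 2
  common-neighbour⇒w≡2 u      _ ()
  common-neighbour⇒w≡2 v      () _
  common-neighbour⇒w≡2 (ℓ i′) () _
  common-neighbour⇒w≡2 (r j′) _ ()
  common-neighbour⇒w≡2 {i} (mid i′ j′) i≡i′ c∼r with toWitness {a? = i ≟ i′} i≡i′ | Equivalence.to T-∧ c∼r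
  common-neighbour⇒w≡2 {j = j} (mid i j′) _ _ | refl | j′≡j , w≡ᵇ2 with toWitness {a? = j′ ≟ j} j′≡j
  ... | refl = ≡ᵇ⇒≡ _ 2 w≡ᵇ2

  short-path : ∀ {i j} k → w i j ≡ k → 1 ≤ k → k ≤ 3 → Path (ℓ i) (r j) k
  short-path {i} {j} 1 w≡1 _ _ = ℓ i ∼⟨ ≡⇒≡ᵇ _ 1 w≡1 ⟩ r j ∎
  short-path {i} {j} 2 w≡2 _ _ =
    ℓ i ∼⟨ fromWitness refl ⟩ mid i j ∼⟨ Equivalence.from T-∧ (fromWitness refl , ≡⇒≡ᵇ _ 2 w≡2) ⟩ r j ∎
  short-path {i} {j} 3 _ _ _ = ℓ i ∼⟨ tt ⟩ u ∼⟨ tt ⟩ v ∼⟨ tt ⟩ r j ∎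
  short-path (suc (suc (suc (suc k)))) _ _ (s≤s (s≤s (s≤s ())))

  Dist-ℓ-r : ∀ i j → 1 ≤ w i j × w i j ≤ 3 → Dist graph (index (ℓ i)) (index (r j)) (w i j)
  Dist-ℓ-r i j (1≤w , w≤3) = index-Dist w≤3 (short-path (w i j) refl 1≤w w≤3) (λ ())
    (λ ℓ∼r → ≤-reflexive (≡ᵇ⇒≡ _ 1 ℓ∼r))
    (λ c ℓ∼c c∼r → ≤-reflexive (common-neighbour⇒w≡2 c ℓ∼c c∼r))

proposition2 : (n : ℕ) (w : Fin n → Fin n → ℕ) →
    (∀ i j → 1 ≤ w i j × w i j ≤ 3) →
    Σ Graph λ G →
    Σ (Fin n → Fin (N G)) λ ℓ →
    Σ (Fin n → Fin (N G)) λ r →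
    Σ (Fin (N G)) λ u →
    Σ (Fin (N G)) λ v →
      Injective _≡_ _≡_ ℓ × Injective _≡_ _≡_ r
      × (∀ i j → ¬ ℓ i ≡ r j)
      × (∀ i → ¬ ℓ i ≡ u) × (∀ i → ¬ ℓ i ≡ v)
      × (∀ j → ¬ r j ≡ u) × (∀ j → ¬ r j ≡ v)
      × ¬ u ≡ v
      × Adj G u v
      × (∀ x → ((Adj G u x × ¬ Adj G v x × ¬ x ≡ v) ⇔ (∃ λ i → ℓ i ≡ x)))
      × (∀ x → ((Adj G v x × ¬ Adj G u x × ¬ x ≡ u) ⇔ (∃ λ j → r j ≡ x)))
      × deg G u ≡ deg G v
      × (∀ i j → Dist G (ℓ i) (r j) (w i j))
proposition2 n w 1≤w≤3 =
  graph , index ∘ ℓ , index ∘ r , index u , index v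
  , (λ e → inj₁-injective (inj₂-injective (index-injective e)))
  , (λ e → inj₁-injective (inj₂-injective (inj₂-injective (index-injective e))))
  , (λ i j → index-≢ {ℓ i} {r j} λ ())
  , (λ i → index-≢ {ℓ i} {u} λ ()) , (λ i → index-≢ {ℓ i} {v} λ ())
  , (λ j → index-≢ {r j} {u} λ ()) , (λ j → index-≢ {r j} {v} λ ())
  , index-≢ {u} {v} (λ ())
  , Adj-index {u} {v} tt
  , index-exclusive-neighbours u-exclusive-neighbours
  , index-exclusive-neighbours v-exclusive-neighbours
  , deg-index swap-↔ v∼swap
  , λ i j → Dist-ℓ-r i j (1≤w≤3 i j)
  where open Construction n w
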